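{- Let $D_\sigma=(V_\sigma,A)$ be a directed graph with a fixed vertex ordering $\sigma=v_1,\dots,v_n$, and let $\mathcal{P}=\{V_1,\dots,V_l\}$ be a partition of $V_\sigma$ into intervals of $\sigma$. Let $A_B$ be the set of arcs with endpoints in different intervals and $A_I$ the set of arcs with both endpoints in the same interval. Assume that the set $F$ of all backward arcs of $D_\sigma[A_B]$ can be certified using only arcs from $A_B$. Then $fas(D_\sigma)=fas(D_\sigma[A_I])+fas(D_\sigma[A_B])$, and there exists a minimum-size feedback arc set of $D_\sigma$ containing $F$.
   Context: An arc $v_iv_j$ is backward if $i>j$ and forward otherwise. For $A'\subseteq A$, $D_\sigma[A']$ is the digraph whose arc set is $A'$ and whose vertex set is the set of endpoints of arcs in $A'$ (with the induced ordering). The span of an arc $v_iv_j$ is the set of vertices $v_{\min(i,j)},\dots,v_{\max(i,j)}$. For a backward arc $f=vu$, a certificate of $f$ is a directed path from $u$ to $v$ using only forward arcs with both endpoints in the span of $f$. A set $F$ of backward arcs can be certified using only arcs from $A'$ if there is a family of pairwise arc-disjoint certificates, one for each $f\in F$, all of whose arcs lie in $A'$. $fas(D)$ denotes the minimum number of arcs whose removal makes $D$ acyclic. -}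

module Defs where

open import Data.Bool using (Bool; true; false; _∧_; not; if_then_else_; T)
open import Data.Nat using (ℕ; _+_) renaming (_≤_ to _≤ℕ_)
open import Data.Fin using (Fin; _≤_; _<_; _≟_)
open import Data.List using (List; []; _∷_; map; allFin)
open import Data.Nat.ListAction using (sum)
open import Data.Product using (Σ; _×_; _,_)
open import Data.Empty using (⊥)
open import Relation.Nullary using (¬_)
open import Relation.Nullary.Decidable using (⌊_⌋)
open import Relation.Binary.PropositionalEquality using (_≡_; _≢_)
open import Relation.Binary.Construct.Closure.Transitive using (TransClosure)
open import Data.List.Membership.Propositional using (_∈_)

-- The digraph D_σ has vertex set Fin n; the ordering σ is v_1,…,v_n = the
-- natural order of Fin n.  An arc set is a Boolean relation on vertices
-- (A i j = true iff v_i v_j is an arc).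
ArcSet : ℕ → Set
ArcSet n = Fin n → Fin n → Bool

_⊆A_ : ∀ {n} → ArcSet n → ArcSet n → Set
S ⊆A A = ∀ i j → T (S i j) → T (A i j)

_∖A_ : ∀ {n} → ArcSet n → ArcSet n → ArcSet n
(A ∖A S) i j = A i j ∧ not (S i j)

size : ∀ {n} → ArcSet n → ℕ
size {n} S = sum (map (λ i → sum (map (λ j → if S i j then 1 else 0) (allFin n))) (allFin n))

-- acyclic: no directed closed walk (equivalently no directed cycle)
Acyclic : ∀ {n} → ArcSet n → Set
Acyclic A = ∀ v → ¬ TransClosure (λ x y → T (A x y)) v v

IsFAS : ∀ {n} → ArcSet n → ArcSet n → Set
IsFAS A S = (S ⊆A A) × Acyclic (A ∖A S)

IsMinFAS : ∀ {n} → ArcSet n → ArcSet n → Set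
IsMinFAS A S = IsFAS A S × (∀ T′ → IsFAS A T′ → size S ≤ℕ size T′)

FasIs : ∀ {n} → ArcSet n → ℕ → Set
FasIs A k = Σ (ArcSet _) λ S → IsMinFAS A S × size S ≡ k

-- A partition of the vertices into intervals of σ is given by a monotone
-- assignment of vertices to parts 0..l-1.
IntervalPartition : ℕ → ℕ → Set
IntervalPartition n l = Σ (Fin n → Fin l) λ part → ∀ i j → i ≤ j → part i ≤ part j

arcsI : ∀ {n l} → IntervalPartition n l → ArcSet n → ArcSet n
arcsI (part , _) A i j = A i j ∧ ⌊ part i ≟ part j ⌋

arcsB : ∀ {n l} → IntervalPartition n l → ArcSet n → ArcSet n
arcsB (part , _) A i j = A i j ∧ not ⌊ part i ≟ part j ⌋

backward : ∀ {n} → ArcSet n → ArcSet n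
backward A i j = A i j ∧ ⌊ Data.Fin._<?_ j i ⌋

data Walk {n} (R : Fin n → Fin n → Set) : Fin n → Fin n → List (Fin n) → Set where
  edge : ∀ {a b} → R a b → Walk R a b (a ∷ b ∷ [])
  step : ∀ {a b c ps} → R a b → Walk R b c ps → Walk R a c (a ∷ ps)

arcsOf : ∀ {n} → List (Fin n) → List (Fin n × Fin n)
arcsOf [] = []
arcsOf (a ∷ []) = []
arcsOf (a ∷ b ∷ ps) = (a , b) ∷ arcsOf (b ∷ ps)

-- certificate of the backward arc f = v u (v = v_i, u = v_j, i > j) using arcs of A':
-- a directed path from u to v using only forward arcs of A' with both endpoints
-- in the span {v_j,…,v_i} of f.
IsCertificate : ∀ {n} → ArcSet n → (i j : Fin n) → List (Fin n) → Set
IsCertificate A′ i j ps =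
  Walk (λ a b → T (A′ a b) × a ≤ b × j ≤ a × a ≤ i × j ≤ b × b ≤ i) j i ps

CanBeCertified : ∀ {n} → ArcSet n → ArcSet n → Set
CanBeCertified {n} F A′ =
  Σ ((i j : Fin n) → T (F i j) → List (Fin n)) λ cert →
    (∀ i j (p : T (F i j)) → IsCertificate A′ i j (cert i j p)) ×
    (∀ i j (p : T (F i j)) i′ j′ (p′ : T (F i′ j′)) → (i , j) ≢ (i′ , j′) →
       ∀ e → e ∈ arcsOf (cert i j p) → e ∈ arcsOf (cert i′ j′ p′) → ⊥)

module Submission where

-- Let I be the arcs inside intervals, B the arcs between intervals and F the
-- backward arcs of B.  The proof has three ingredients.
--   * Hitting: if X ⊇ B and U makes X acyclic, then U contains at least |F|
--     arcs of B.  Each f ∈ F closes a cycle with its certificate, so U meets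
--     f or its certificate; distinct f are charged to distinct arcs because
--     certificates are arc-disjoint and consist of forward arcs only.
--   * Layering: forward arcs of B strictly increase the interval index, so
--     for every feedback arc set S_I of I, the set S_I ∪ F is a feedback arc
--     set of the whole digraph; F alone is a feedback arc set of B.
--   * Counting: every feedback arc set U of A splits into U ∩ I (a feedback arc
--     set of I) and U ∩ B (of size ≥ |F|), hence |U| ≥ fas(I) + |F|.
-- So S_I ∪ F is minimum whenever S_I is, fas(B) = |F| and fas(A) = fas(I) + |F|.
-- A minimum feedback arc set of I exists constructively: arc sets form a
-- searchable type and acyclicity is decidable (a reachability fixpoint), so
-- one descends on size.

open import Defs
open import Data.Nat using (ℕ; zero; suc; _+_; z≤n; s≤s; s≤s⁻¹) renaming (_≤_ to _≤ℕ_; _<_ to _<ℕ_)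
open import Data.Nat.Properties using (≤-refl; ≤-trans; ≤-reflexive; ≤-antisym; +-mono-≤; +-suc; <-irrefl; <-trans; <-≤-trans; ≤-<-trans; <⇒≱; ≮⇒≥; m≤n⇒m≤1+n; +-commutativeSemigroup)
import Data.Nat.Properties as ℕ
open import Data.Nat.ListAction using (sum)
open import Data.Nat.ListAction.Properties using (sum-++)
open import Algebra.Properties.CommutativeSemigroup +-commutativeSemigroup using (interchange)
open import Data.Bool using (Bool; true; false; T; _∧_; _∨_; not; if_then_else_)
open import Data.Bool.Properties using (T-∧; T-∨)
open import Data.Unit using (tt)
open import Data.Empty using (⊥; ⊥-elim)
open import Data.Sum using (_⊎_; inj₁; inj₂)
open import Data.Product using (Σ; _×_; ∃; _,_; proj₁; proj₂)
open import Data.Product.Properties using (≡-dec)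
open import Data.Fin using (Fin; zero; suc; toℕ) renaming (_≤_ to _≤F_; _<_ to _<F_)
open import Data.Fin.Properties using (any?; all?; ≤∧≢⇒<) renaming (_≟_ to _≟F_)
import Data.Vec.Functional as Vector
open import Data.List using (List; []; _∷_; _++_; map; allFin; length; filter; cartesianProduct; removeAt)
open import Data.List.Properties using (map-++; map-cong; map-∘; length-removeAt′)
open import Data.List.Membership.Propositional using (_∈_)
open import Data.List.Membership.Propositional.Properties using (∈-filter⁺; ∈-filter⁻; ∈-cartesianProduct⁺; ∈-allFin)
open import Data.List.Relation.Unary.Any using (here; there; index)
import Data.List.Relation.Unary.All as All
open import Data.List.Relation.Unary.AllPairs using (_∷_)
open import Data.List.Relation.Unary.Unique.Propositional using (Unique)
open import Data.List.Relation.Unary.Unique.Propositional.Properties using (filter⁺; cartesianProduct⁺; allFin⁺)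
open import Function using (Equivalence; id; _∘_)
open import Relation.Nullary using (¬_; Dec; yes; no; ¬?)
open import Relation.Nullary.Decidable using (⌊_⌋; T?; toWitness; fromWitness; toWitnessFalse; fromWitnessFalse; decidable-stable; _×-dec_; _⊎-dec_; _→-dec_; map′)
open import Relation.Binary.PropositionalEquality using (_≡_; _≢_; refl; sym; trans; cong; cong₂; subst; subst₂; module ≡-Reasoning)
open import Relation.Binary.Construct.Closure.Transitive using (TransClosure; [_]; _∷_; _∷ʳ_)

∧⁻ : ∀ {a b} → T (a ∧ b) → T a × T b
∧⁻ = Equivalence.to T-∧

∧⁺ : ∀ {a b} → T a → T b → T (a ∧ b)
∧⁺ ta tb = Equivalence.from T-∧ (ta , tb)

∨⁻ : ∀ {a b} → T (a ∨ b) → T a ⊎ T b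
∨⁻ = Equivalence.to T-∨

∨⁺ˡ : ∀ {a b} → T a → T (a ∨ b)
∨⁺ˡ ta = Equivalence.from T-∨ (inj₁ ta)

∨⁺ʳ : ∀ {a b} → T b → T (a ∨ b)
∨⁺ʳ tb = Equivalence.from T-∨ (inj₂ tb)

not⁻ : ∀ {b} → T (not b) → ¬ T b
not⁻ {true} () _
not⁻ {false} _ ()

not⁺ : ∀ {b} → ¬ T b → T (not b)
not⁺ {true} ¬t = ¬t tt
not⁺ {false} _ = tt

_∪A_ : ∀ {n} → ArcSet n → ArcSet n → ArcSet n
(S ∪A S′) i j = S i j ∨ S′ i j

_∩A_ : ∀ {n} → ArcSet n → ArcSet n → ArcSet n
(S ∩A S′) i j = S i j ∧ S′ i j

∖A⁻ : ∀ {x s} → T (x ∧ not s) → T x × ¬ T s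
∖A⁻ t = let (x , ns) = ∧⁻ t in x , not⁻ ns

∖A⁺ : ∀ {x s} → T x → ¬ T s → T (x ∧ not s)
∖A⁺ x ns = ∧⁺ x (not⁺ ns)

-- Counting arcs.  The size of an arc set is the double sum of the indicator
-- χ (S i j); all inequalities between sizes come from pointwise ones.

χ : Bool → ℕ
χ b = if b then 1 else 0

sum-map-mono : ∀ {X : Set} {f g : X → ℕ} → (∀ x → f x ≤ℕ g x) →
               ∀ xs → sum (map f xs) ≤ℕ sum (map g xs)
sum-map-mono f≤g [] = z≤n
sum-map-mono f≤g (x ∷ xs) = +-mono-≤ (f≤g x) (sum-map-mono f≤g xs)

sum-map-+ : ∀ {X : Set} (f g : X → ℕ) xs →
            sum (map (λ x → f x + g x) xs) ≡ sum (map f xs) + sum (map g xs)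
sum-map-+ f g [] = refl
sum-map-+ f g (x ∷ xs) = trans (cong (f x + g x +_) (sum-map-+ f g xs))
                               (interchange (f x) (g x) (sum (map f xs)) (sum (map g xs)))

weight : ∀ {n} → (Fin n → Fin n → ℕ) → ℕ
weight {n} w = sum (map (λ i → sum (map (w i) (allFin n))) (allFin n))

weight-mono : ∀ {n} {w w′ : Fin n → Fin n → ℕ} → (∀ i j → w i j ≤ℕ w′ i j) → weight w ≤ℕ weight w′
weight-mono {n} le = sum-map-mono (λ i → sum-map-mono (le i) (allFin n)) (allFin n)

weight-+ : ∀ {n} (w w′ : Fin n → Fin n → ℕ) → weight (λ i j → w i j + w′ i j) ≡ weight w + weight w′
weight-+ {n} w w′ = trans (cong sum (map-cong (λ i → sum-map-+ (w i) (w′ i) (allFin n)) (allFin n)))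
                          (sum-map-+ _ _ (allFin n))

χ-mono : ∀ {a b} → (T a → T b) → χ a ≤ℕ χ b
χ-mono {false} _ = z≤n
χ-mono {true} {true} _ = ≤-refl
χ-mono {true} {false} a⇒b = ⊥-elim (a⇒b tt)

size-mono : ∀ {n} {S S′ : ArcSet n} → S ⊆A S′ → size S ≤ℕ size S′
size-mono S⊆S′ = weight-mono (λ i j → χ-mono (S⊆S′ i j))

size-cong : ∀ {n} {S S′ : ArcSet n} → (∀ i j → S i j ≡ S′ i j) → size S ≡ size S′
size-cong S≗S′ = ≤-antisym (size-mono (λ i j → subst T (S≗S′ i j)))
                           (size-mono (λ i j → subst T (sym (S≗S′ i j))))

size-∪ : ∀ {n} (S S′ : ArcSet n) → size (S ∪A S′) ≤ℕ size S + size S′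
size-∪ S S′ = ≤-trans (weight-mono (λ i j → χ-∨ (S i j) (S′ i j)))
                      (≤-reflexive (weight-+ (λ i j → χ (S i j)) (λ i j → χ (S′ i j))))
  where
  χ-∨ : ∀ a b → χ (a ∨ b) ≤ℕ χ a + χ b
  χ-∨ true b = s≤s z≤n
  χ-∨ false b = ≤-refl

size-∩-disjoint : ∀ {n} (S X Y : ArcSet n) → (∀ i j → T (X i j) → ¬ T (Y i j)) →
                  size (S ∩A X) + size (S ∩A Y) ≤ℕ size S
size-∩-disjoint S X Y disj = ≤-trans (≤-reflexive (sym (weight-+ (λ i j → χ ((S ∩A X) i j)) (λ i j → χ ((S ∩A Y) i j)))))
                                     (weight-mono (λ i j → χ-split (S i j) (X i j) (Y i j) (disj i j)))
  where
  χ-split : ∀ s x y → (T x → ¬ T y) → χ (s ∧ x) + χ (s ∧ y) ≤ℕ χ s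
  χ-split false x y _ = z≤n
  χ-split true false y _ = χ-mono {y} {true} _
  χ-split true true false _ = ≤-refl
  χ-split true true true d = ⊥-elim (d tt tt)

∈-removeAt : ∀ {X : Set} {y w : X} {ys} (p : y ∈ ys) → w ∈ ys → w ≢ y → w ∈ removeAt ys (index p)
∈-removeAt (here refl) (here refl) w≢y = ⊥-elim (w≢y refl)
∈-removeAt (here refl) (there q) _ = q
∈-removeAt (there p) (here refl) _ = here refl
∈-removeAt (there p) (there q) w≢y = there (∈-removeAt p q w≢y)

injection-length : ∀ {X Y : Set} (R : X → Y → Set) {xs : List X} {ys : List Y} → Unique xs →
                   (∀ {x} → x ∈ xs → ∃ λ y → y ∈ ys × R x y) →
                   (∀ {x x′ y} → R x y → R x′ y → x ≡ x′) → length xs ≤ℕ length ys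
injection-length R {[]} _ _ _ = z≤n
injection-length R {x ∷ xs} {ys} (x∉xs ∷ unique) image injective with image (here refl)
... | y , y∈ys , xRy = begin
  suc (length xs)                         ≤⟨ s≤s (injection-length R unique image′ injective) ⟩
  suc (length (removeAt ys (index y∈ys))) ≡⟨ length-removeAt′ ys (index y∈ys) ⟨
  length ys                               ∎
  where
  open ℕ.≤-Reasoning
  image′ : ∀ {x′} → x′ ∈ xs → ∃ λ y′ → y′ ∈ removeAt ys (index y∈ys) × R x′ y′
  image′ x′∈xs with image (there x′∈xs)
  ... | y′ , y′∈ys , x′Ry′ =
    y′ , ∈-removeAt y∈ys y′∈ys (λ { refl → All.lookup x∉xs x′∈xs (injective xRy x′Ry′) }) , x′Ry′

arcList : ∀ {n} → ArcSet n → List (Fin n × Fin n)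
arcList {n} S = filter (λ e → T? (S (proj₁ e) (proj₂ e))) (cartesianProduct (allFin n) (allFin n))

length-filter-χ : ∀ {X : Set} (p : X → Bool) xs → length (filter (T? ∘ p) xs) ≡ sum (map (χ ∘ p) xs)
length-filter-χ p [] = refl
length-filter-χ p (x ∷ xs) with p x
... | true = cong suc (length-filter-χ p xs)
... | false = length-filter-χ p xs

sum-cartesianProduct : ∀ {X Y : Set} (g : X × Y → ℕ) xs ys →
  sum (map g (cartesianProduct xs ys)) ≡ sum (map (λ x → sum (map (λ y → g (x , y)) ys)) xs)
sum-cartesianProduct g [] ys = refl
sum-cartesianProduct g (x ∷ xs) ys = begin
  sum (map g (map (x ,_) ys ++ cartesianProduct xs ys))
    ≡⟨ cong sum (map-++ g (map (x ,_) ys) _) ⟩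
  sum (map g (map (x ,_) ys) ++ map g (cartesianProduct xs ys))
    ≡⟨ sum-++ (map g (map (x ,_) ys)) _ ⟩
  sum (map g (map (x ,_) ys)) + sum (map g (cartesianProduct xs ys))
    ≡⟨ cong₂ _+_ (sym (cong sum (map-∘ ys))) (sum-cartesianProduct g xs ys) ⟩
  sum (map (λ y → g (x , y)) ys) + sum (map (λ x → sum (map (λ y → g (x , y)) ys)) xs) ∎
  where open ≡-Reasoning

length-arcList : ∀ {n} (S : ArcSet n) → length (arcList S) ≡ size S
length-arcList {n} S =
  trans (length-filter-χ (λ e → S (proj₁ e) (proj₂ e)) (cartesianProduct (allFin n) (allFin n)))
        (sum-cartesianProduct (λ e → χ (S (proj₁ e) (proj₂ e))) (allFin n) (allFin n))

∈-arcList⁺ : ∀ {n} {S : ArcSet n} {i j} → T (S i j) → (i , j) ∈ arcList S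
∈-arcList⁺ {S = S} = ∈-filter⁺ (λ e → T? (S (proj₁ e) (proj₂ e))) (∈-cartesianProduct⁺ (∈-allFin _) (∈-allFin _))

∈-arcList⁻ : ∀ {n} {S : ArcSet n} {e} → e ∈ arcList S → T (S (proj₁ e) (proj₂ e))
∈-arcList⁻ {n} {S = S} e∈ = proj₂ (∈-filter⁻ (λ e → T? (S (proj₁ e) (proj₂ e))) {xs = cartesianProduct (allFin n) (allFin n)} e∈)

unique-arcList : ∀ {n} (S : ArcSet n) → Unique (arcList S)
unique-arcList {n} S = filter⁺ _ (cartesianProduct⁺ (allFin⁺ n) (allFin⁺ n))

size-injection : ∀ {n} {S S′ : ArcSet n} (R : Fin n × Fin n → Fin n × Fin n → Set) →
  (∀ {i j} → T (S i j) → ∃ λ e → T (S′ (proj₁ e) (proj₂ e)) × R (i , j) e) →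
  (∀ {x x′ e} → R x e → R x′ e → x ≡ x′) → size S ≤ℕ size S′
size-injection {S = S} {S′} R image injective =
  subst₂ _≤ℕ_ (length-arcList S) (length-arcList S′)
    (injection-length R (unique-arcList S) image′ injective)
  where
  image′ : ∀ {x} → x ∈ arcList S → ∃ λ e → e ∈ arcList S′ × R x e
  image′ x∈ = let (e , e∈S′ , xRe) = image (∈-arcList⁻ x∈) in e , ∈-arcList⁺ e∈S′ , xRe

VertexSet : ℕ → Set
VertexSet n = Fin n → Bool

_⊆V_ : ∀ {n} → VertexSet n → VertexSet n → Set
s ⊆V t = ∀ y → T (s y) → T (t y)

card : ∀ {n} → VertexSet n → ℕ
card {zero} s = 0
card {suc n} s = χ (s zero) + card (s ∘ suc)

card-≤ : ∀ {n} (s : VertexSet n) → card s ≤ℕ n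
card-≤ {zero} s = z≤n
card-≤ {suc n} s with s zero
... | true = s≤s (card-≤ (s ∘ suc))
... | false = m≤n⇒m≤1+n (card-≤ (s ∘ suc))

card-mono : ∀ {n} {s t : VertexSet n} → s ⊆V t → card s ≤ℕ card t
card-mono {zero} s⊆t = z≤n
card-mono {suc n} s⊆t = +-mono-≤ (χ-mono (s⊆t zero)) (card-mono (s⊆t ∘ suc))

card-grow : ∀ {n} {s t : VertexSet n} → s ⊆V t → ∀ {y} → T (t y) → ¬ T (s y) → suc (card s) ≤ℕ card t
card-grow {suc n} {s} {t} s⊆t {zero} ty ¬sy with s zero | t zero
... | true | _ = ⊥-elim (¬sy tt)
... | false | true = s≤s (card-mono (s⊆t ∘ suc))
card-grow {suc n} {s} {t} s⊆t {suc y} ty ¬sy =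
  ≤-trans (≤-reflexive (sym (+-suc (χ (s zero)) (card (s ∘ suc)))))
          (+-mono-≤ (χ-mono (s⊆t zero)) (card-grow (s⊆t ∘ suc) ty ¬sy))

Within : ∀ {n} → (Fin n → Set) → VertexSet n → Set
Within Good s = ∀ y → T (s y) → Good y

saturate : ∀ {n} (Good : Fin n → Set) (op : VertexSet n → VertexSet n) →
  (∀ s → s ⊆V op s) → (∀ s → Within Good s → Within Good (op s)) →
  ∀ s → Within Good s → Σ (VertexSet n) λ t → s ⊆V t × op t ⊆V t × Within Good t
saturate {n} Good op inflationary preserves s good = iterate n s (ℕ.m≤m+n n (card s)) good
  where
  iterate : ∀ fuel s → n ≤ℕ fuel + card s → Within Good s →
            Σ (VertexSet n) λ t → s ⊆V t × op t ⊆V t × Within Good t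
  iterate fuel s bound good with any? (λ y → T? (op s y) ×-dec ¬? (T? (s y)))
  ... | no noNew = s , (λ y → id) , (λ y sy → decidable-stable (T? (s y)) (λ ¬sy → noNew (y , sy , ¬sy))) , good
  ... | yes (y , new , old) = next fuel bound (card-grow (inflationary s) new old)
    where
    -- the fuel spent on this step is paid for by the new element
    fuel-left : ∀ fuel → n ≤ℕ suc fuel + card s → suc (card s) ≤ℕ card (op s) → n ≤ℕ fuel + card (op s)
    fuel-left fuel bound grows =
      ≤-trans bound (≤-trans (≤-reflexive (sym (+-suc fuel (card s)))) (ℕ.+-monoʳ-≤ fuel grows))
    next : ∀ fuel → n ≤ℕ fuel + card s → suc (card s) ≤ℕ card (op s) →
           Σ (VertexSet n) λ t → s ⊆V t × op t ⊆V t × Within Good t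
    next zero bound grows = ⊥-elim (<-irrefl refl (≤-trans grows (≤-trans (card-≤ (op s)) bound)))
    next (suc fuel) bound grows =
      let (t , op-s⊆t , closed , good-t) = iterate fuel (op s) (fuel-left fuel bound grows) (preserves s good)
      in t , (λ y → op-s⊆t y ∘ inflationary s y) , closed , good-t

Path : ∀ {n} → ArcSet n → Fin n → Fin n → Set
Path G = TransClosure (λ x y → T (G x y))

-- Reachability is decidable: saturate the out-neighbourhood of v under adding
-- all out-neighbours; the result is exactly the set of vertices reachable from v.
module Reachability {n : ℕ} (G : ArcSet n) (v : Fin n) where

  expand : VertexSet n → VertexSet n
  expand s y = s y ∨ ⌊ any? (λ z → T? (s z ∧ G z y)) ⌋

  expand-reachable : ∀ s → Within (Path G v) s → Within (Path G v) (expand s)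
  expand-reachable s reachable y t with ∨⁻ t
  ... | inj₁ sy = reachable y sy
  ... | inj₂ viaZ = let (z , szGzy) = toWitness viaZ ; (sz , gzy) = ∧⁻ szGzy in reachable z sz ∷ʳ gzy

  reachable? : ∀ w → Dec (Path G v w)
  reachable? w with saturate (Path G v) expand (λ s y → ∨⁺ˡ) expand-reachable (G v) (λ y e → [ e ])
  ... | t , out⊆t , closed , reachable with T? (t w)
  ... | yes tw = yes (reachable w tw)
  ... | no ¬tw = no λ p → ¬tw (reached p)
    where
    arc-closed : ∀ {x y} → T (t x) → T (G x y) → T (t y)
    arc-closed {x} {y} tx gxy = closed y (∨⁺ʳ {t y} (fromWitness {a? = any? λ z → T? (t z ∧ G z y)} (x , ∧⁺ tx gxy)))
    along : ∀ {x y} → T (t x) → Path G x y → T (t y)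
    along tx [ e ] = arc-closed tx e
    along tx (e ∷ p) = along (arc-closed tx e) p
    reached : ∀ {y} → Path G v y → T (t y)
    reached [ e ] = out⊆t _ e
    reached (e ∷ p) = along (out⊆t _ e) p

acyclic? : ∀ {n} (G : ArcSet n) → Dec (Acyclic G)
acyclic? G = all? (λ v → ¬? (Reachability.reachable? G v v))

path-⊆ : ∀ {n} {G G′ : ArcSet n} → G′ ⊆A G → ∀ {x y} → Path G′ x y → Path G x y
path-⊆ G′⊆G [ e ] = [ G′⊆G _ _ e ]
path-⊆ G′⊆G (e ∷ p) = G′⊆G _ _ e ∷ path-⊆ G′⊆G p

acyclic-⊆ : ∀ {n} {G G′ : ArcSet n} → G′ ⊆A G → Acyclic G → Acyclic G′
acyclic-⊆ G′⊆G acyclic v cycle = acyclic v (path-⊆ G′⊆G cycle)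

fas? : ∀ {n} (X S : ArcSet n) → Dec (IsFAS X S)
fas? X S = all? (λ i → all? (λ j → T? (S i j) →-dec T? (X i j))) ×-dec acyclic? (X ∖A S)

fas-resp : ∀ {n} {X S S′ : ArcSet n} → (∀ i j → S i j ≡ S′ i j) → IsFAS X S → IsFAS X S′
fas-resp S≗S′ (S⊆X , acyclic) =
  (λ i j s′ → S⊆X i j (subst T (sym (S≗S′ i j)) s′)) ,
  acyclic-⊆ (λ i j t → let (x , ¬s′) = ∖A⁻ t in ∖A⁺ x (¬s′ ∘ subst T (S≗S′ i j))) acyclic

all-arcs-fas : ∀ {n} (X : ArcSet n) → IsFAS X X
all-arcs-fas X = (λ i j x → x) , λ v → no-first-arc
  where
  no-first-arc : ∀ {x y} → ¬ Path (X ∖A X) x y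
  no-first-arc {x} {y} [ e ] = let (xy , ¬xy) = ∖A⁻ {X x y} e in ¬xy xy
  no-first-arc {x} (_∷_ {y = y} e _) = let (xy , ¬xy) = ∖A⁻ {X x y} e in ¬xy xy

Searchable : (X : Set) → (X → X → Set) → Set₁
Searchable X _≈_ = ∀ {P : X → Set} → (∀ {x y} → x ≈ y → P x → P y) → (∀ x → Dec (P x)) → Dec (∃ P)

searchable-Bool : Searchable Bool _≡_
searchable-Bool {P} _ P? = map′ witness cases (P? true ⊎-dec P? false)
  where
  witness : P true ⊎ P false → ∃ P
  witness (inj₁ p) = true , p
  witness (inj₂ p) = false , p
  cases : ∃ P → P true ⊎ P false
  cases (true , p) = inj₁ p
  cases (false , p) = inj₂ p

searchable-Π : ∀ {X : Set} {_≈_ : X → X → Set} → (∀ {x} → x ≈ x) → Searchable X _≈_ →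
               ∀ m → Searchable (Fin m → X) (λ f g → ∀ i → f i ≈ g i)
searchable-Π ≈-refl search zero {P} resp P? with P? (λ ())
... | yes p = yes (_ , p)
... | no ¬p = no λ (f , pf) → ¬p (resp (λ ()) pf)
searchable-Π {_≈_ = _≈_} ≈-refl search (suc m) {P} resp P? =
  map′ (λ (x , g , p) → x Vector.∷ g , p) (λ (f , p) → f zero , f ∘ suc , resp (head-tail f) p)
       (search (λ x≈y (g , p) → g , resp (cons-cong x≈y (λ _ → ≈-refl)) p)
               (λ x → searchable-Π ≈-refl search m (λ g≈h → resp (cons-cong ≈-refl g≈h)) (λ g → P? (x Vector.∷ g))))
  where
  cons-cong : ∀ {x y g h} → x ≈ y → (∀ i → g i ≈ h i) → ∀ i → (x Vector.∷ g) i ≈ (y Vector.∷ h) i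
  cons-cong x≈y g≈h zero = x≈y
  cons-cong x≈y g≈h (suc i) = g≈h i
  head-tail : ∀ f i → f i ≈ (f zero Vector.∷ f ∘ suc) i
  head-tail f zero = ≈-refl
  head-tail f (suc i) = ≈-refl

searchable-ArcSet : ∀ n → Searchable (ArcSet n) (λ S S′ → ∀ i j → S i j ≡ S′ i j)
searchable-ArcSet n = searchable-Π (λ j → refl) (searchable-Π refl searchable-Bool n) n

minimise : ∀ {X : Set} {_≈_ : X → X → Set} → Searchable X _≈_ →
  (μ : X → ℕ) → (∀ {x y} → x ≈ y → μ x ≡ μ y) →
  {P : X → Set} → (∀ {x y} → x ≈ y → P x → P y) → (∀ x → Dec (P x)) →
  ∀ {x₀} → P x₀ → Σ X λ x → P x × (∀ y → P y → μ x ≤ℕ μ y)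
minimise {X} search μ μ-resp {P} resp P? {x₀} p₀ = descend (suc (μ x₀)) x₀ p₀ (ℕ.n<1+n (μ x₀))
  where
  descend : ∀ k x → P x → μ x <ℕ k → Σ X λ x → P x × (∀ y → P y → μ x ≤ℕ μ y)
  descend (suc k) x px μx<k
    with search (λ x≈y (py , lt) → resp x≈y py , subst (_<ℕ μ x) (μ-resp x≈y) lt)
                (λ y → P? y ×-dec (μ y ℕ.<? μ x))
  ... | yes (y , py , μy<μx) = descend k y py (<-≤-trans μy<μx (s≤s⁻¹ μx<k))
  ... | no noSmaller = x , px , λ y py → ≮⇒≥ (λ μy<μx → noSmaller (y , py , μy<μx))

minimum-fas : ∀ {n} (X : ArcSet n) → Σ (ArcSet n) (IsMinFAS X)
minimum-fas {n} X = minimise (searchable-ArcSet n) size size-cong fas-resp (fas? X) (all-arcs-fas X)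

module _ {n : ℕ} {R : Fin n → Fin n → Set} where

  arcsOf-step : ∀ {a b c ps} → Walk R b c ps → arcsOf (a ∷ ps) ≡ (a , b) ∷ arcsOf ps
  arcsOf-step (edge _) = refl
  arcsOf-step (step _ _) = refl

  walk-arcs : ∀ {a c ps} → Walk R a c ps → ∀ {e} → e ∈ arcsOf ps → R (proj₁ e) (proj₂ e)
  walk-arcs (edge r) (here refl) = r
  walk-arcs (step r w) e∈ with subst (_ ∈_) (arcsOf-step w) e∈
  ... | here refl = r
  ... | there e∈′ = walk-arcs w e∈′

  walk-meets-or-avoids : ∀ {X U : ArcSet n} → (∀ a b → R a b → T (X a b)) → ∀ {a c ps} → Walk R a c ps →
    (∃ λ e → e ∈ arcsOf ps × T (U (proj₁ e) (proj₂ e))) ⊎ Path (X ∖A U) a c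
  walk-meets-or-avoids {U = U} R⊆X (edge {a} {b} r) with T? (U a b)
  ... | yes u = inj₁ ((a , b) , here refl , u)
  ... | no ¬u = inj₂ [ ∖A⁺ (R⊆X a b r) ¬u ]
  walk-meets-or-avoids {U = U} R⊆X (step {a} {b} r w) with T? (U a b)
  ... | yes u = inj₁ ((a , b) , subst (_ ∈_) (sym (arcsOf-step w)) (here refl) , u)
  ... | no ¬u with walk-meets-or-avoids R⊆X w
  ...   | inj₁ (e , e∈ , u) = inj₁ (e , subst (_ ∈_) (sym (arcsOf-step w)) (there e∈) , u)
  ...   | inj₂ path = inj₂ (∖A⁺ (R⊆X a b r) ¬u ∷ path)

layered-path : ∀ {n} {G H : ArcSet n} (p : Fin n → ℕ) →
  (∀ x y → T (G x y) → p x <ℕ p y ⊎ (T (H x y) × p x ≡ p y)) →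
  ∀ {x y} → Path G x y → p x <ℕ p y ⊎ (Path H x y × p x ≡ p y)
layered-path p classify [ e ] with classify _ _ e
... | inj₁ lt = inj₁ lt
... | inj₂ (h , same) = inj₂ ([ h ] , same)
layered-path p classify (e ∷ q) with classify _ _ e | layered-path p classify q
... | inj₁ lt | inj₁ lt′ = inj₁ (<-trans lt lt′)
... | inj₁ lt | inj₂ (_ , same′) = inj₁ (<-≤-trans lt (≤-reflexive same′))
... | inj₂ (_ , same) | inj₁ lt′ = inj₁ (≤-<-trans (≤-reflexive same) lt′)
... | inj₂ (h , same) | inj₂ (hq , same′) = inj₂ (h ∷ hq , trans same same′)

-- Hence G is acyclic as soon as H is: a cycle cannot raise p.
layered-acyclic : ∀ {n} {G : ArcSet n} (p : Fin n → ℕ) (H : ArcSet n) → Acyclic H →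
  (∀ x y → T (G x y) → p x <ℕ p y ⊎ (T (H x y) × p x ≡ p y)) → Acyclic G
layered-acyclic p H acyclic-H classify v cycle with layered-path p classify cycle
... | inj₁ pv<pv = <-irrefl refl pv<pv
... | inj₂ (cycle-H , _) = acyclic-H v cycle-H

∅A : ∀ {n} → ArcSet n
∅A _ _ = false

∅A-acyclic : ∀ {n} → Acyclic (∅A {n})
∅A-acyclic v [ () ]
∅A-acyclic v (() ∷ _)

module Decomposition {n l : ℕ} (A : ArcSet n) (P : IntervalPartition n l)
                     (certified : CanBeCertified (backward (arcsB P A)) (arcsB P A)) where

  part : Fin n → Fin l
  part = proj₁ P

  I B F : ArcSet n
  I = arcsI P A
  B = arcsB P A
  F = backward B

  cert : ∀ i j → T (F i j) → List (Fin n)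
  cert = proj₁ certified

  cert-valid : ∀ i j (f : T (F i j)) → IsCertificate B i j (cert i j f)
  cert-valid = proj₁ (proj₂ certified)

  cert-disjoint : ∀ i j (f : T (F i j)) i′ j′ (f′ : T (F i′ j′)) → (i , j) ≢ (i′ , j′) →
                  ∀ e → e ∈ arcsOf (cert i j f) → e ∈ arcsOf (cert i′ j′ f′) → ⊥
  cert-disjoint = proj₂ (proj₂ certified)

  I-arc : ∀ {x y} → T (I x y) → T (A x y) × part x ≡ part y
  I-arc t = let (a , same) = ∧⁻ t in a , toWitness same

  B-arc : ∀ {x y} → T (B x y) → T (A x y) × part x ≢ part y
  B-arc t = let (a , different) = ∧⁻ t in a , toWitnessFalse different

  F-arc : ∀ {x y} → T (F x y) → T (B x y) × y <F x
  F-arc t = let (b , back) = ∧⁻ t in b , toWitness back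

  -- A forward arc of B goes to a later vertex in a strictly later interval
  -- (intervals are ordered consistently with σ).
  forward-B-arc : ∀ {x y} → T (B x y) → ¬ T (F x y) → x <F y × part x <F part y
  forward-B-arc {x} {y} b ¬f = x<y , ≤∧≢⇒< (proj₂ P x y (ℕ.<⇒≤ x<y)) different
    where
    different : part x ≢ part y
    different = proj₂ (B-arc b)
    x<y : x <F y
    x<y = ≤∧≢⇒< (≮⇒≥ (λ y<x → ¬f (∧⁺ b (fromWitness y<x)))) (λ { refl → different refl })

  cert-arc : ∀ {i j} (f : T (F i j)) {e} → e ∈ arcsOf (cert i j f) → T (B (proj₁ e) (proj₂ e)) × proj₁ e ≤F proj₂ e
  cert-arc {i} {j} f e∈ = let (b , forward , _) = walk-arcs (cert-valid i j f) e∈ in b , forward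

  F-not-on-cert : ∀ {i j i′ j′} → T (F i j) → (f′ : T (F i′ j′)) → ¬ (i , j) ∈ arcsOf (cert i′ j′ f′)
  F-not-on-cert f f′ e∈ = <⇒≱ (proj₂ (F-arc f)) (proj₂ (cert-arc f′ e∈))

  -- No arc is charged to two backward arcs: certificates are pairwise
  -- arc-disjoint and contain no backward arc.
  Charged : Fin n × Fin n → Fin n × Fin n → Set
  Charged (i , j) e = Σ (T (F i j)) λ f → e ≡ (i , j) ⊎ e ∈ arcsOf (cert i j f)

  charged-injective : ∀ {x x′ e} → Charged x e → Charged x′ e → x ≡ x′
  charged-injective (f , inj₁ refl) (f′ , inj₁ refl) = refl
  charged-injective (f , inj₁ refl) (f′ , inj₂ e∈′) = ⊥-elim (F-not-on-cert f f′ e∈′)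
  charged-injective (f , inj₂ e∈) (f′ , inj₁ refl) = ⊥-elim (F-not-on-cert f′ f e∈)
  charged-injective {i , j} {i′ , j′} {e} (f , inj₂ e∈) (f′ , inj₂ e∈′) =
    decidable-stable (≡-dec _≟F_ _≟F_ (i , j) (i′ , j′))
                     (λ distinct → cert-disjoint i j f i′ j′ f′ distinct e e∈ e∈′)

  -- Each backward arc and its certificate form a cycle of X, so U
  -- contains an arc of it, and that arc is charged to the backward arc.
  hitting : ∀ {X U : ArcSet n} → B ⊆A X → Acyclic (X ∖A U) → size F ≤ℕ size (U ∩A B)
  hitting {X} {U} B⊆X acyclic = size-injection Charged charge charged-injective
    where
    charge : ∀ {i j} → T (F i j) → ∃ λ e → T ((U ∩A B) (proj₁ e) (proj₂ e)) × Charged (i , j) e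
    charge {i} {j} f with T? (U i j)
    ... | yes u = (i , j) , ∧⁺ u (proj₁ (F-arc f)) , f , inj₁ refl
    ... | no ¬u with walk-meets-or-avoids (λ a b r → B⊆X a b (proj₁ r)) (cert-valid i j f)
    ...   | inj₁ (e , e∈ , u) = e , ∧⁺ u (proj₁ (cert-arc f e∈)) , f , inj₂ e∈
    ...   | inj₂ path = ⊥-elim (acyclic i (∖A⁺ (B⊆X i j (proj₁ (F-arc f))) ¬u ∷ path))

  -- F is a feedback arc set of B: the remaining arcs all go forward in σ.
  F-fas : IsFAS B F
  F-fas = (λ i j f → proj₁ (F-arc f)) ,
          layered-acyclic toℕ ∅A ∅A-acyclic
            (λ x y t → let (b , ¬f) = ∖A⁻ {B x y} t in inj₁ (proj₁ (forward-B-arc b ¬f)))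

  fas-B : ∀ {SB} → IsMinFAS B SB → size SB ≡ size F
  fas-B {SB} ((_ , acyclic) , least) =
    ≤-antisym (least F F-fas) (≤-trans (hitting (λ i j b → b) acyclic) (size-mono {S = SB ∩A B} (λ i j t → proj₁ (∧⁻ {SB i j} t))))

  -- For a feedback arc set S_I of I, S_I ∪ F is one of A: the remaining arcs are
  -- arcs of I ∖ S_I, inside one interval, or forward arcs of B, to a later interval.
  union-fas : ∀ {SI} → IsFAS I SI → IsFAS A (SI ∪A F)
  union-fas {SI} (SI⊆I , acyclic-I) = ⊆A , layered-acyclic (toℕ ∘ part) (I ∖A SI) acyclic-I classify
    where
    ⊆A : (SI ∪A F) ⊆A A
    ⊆A i j t with ∨⁻ t
    ... | inj₁ s = proj₁ (I-arc (SI⊆I i j s))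
    ... | inj₂ f = proj₁ (B-arc (proj₁ (F-arc f)))
    classify : ∀ x y → T ((A ∖A (SI ∪A F)) x y) →
               toℕ (part x) <ℕ toℕ (part y) ⊎ (T ((I ∖A SI) x y) × toℕ (part x) ≡ toℕ (part y))
    classify x y t = by-interval (∖A⁻ {A x y} t) (part x ≟F part y)
      where
      by-interval : T (A x y) × ¬ T ((SI ∪A F) x y) → Dec (part x ≡ part y) →
                    toℕ (part x) <ℕ toℕ (part y) ⊎ (T ((I ∖A SI) x y) × toℕ (part x) ≡ toℕ (part y))
      by-interval (a , ¬s) (yes same) =
        inj₂ (∖A⁺ (∧⁺ a (fromWitness {a? = part x ≟F part y} same)) (¬s ∘ ∨⁺ˡ) , cong toℕ same)
      by-interval (a , ¬s) (no different) =
        inj₁ (proj₂ (forward-B-arc (∧⁺ a (fromWitnessFalse {a? = part x ≟F part y} different)) (¬s ∘ ∨⁺ʳ)))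

  -- Lower bound: a feedback arc set U of A contains the feedback arc set U ∩ I
  -- of I and, by the hitting lemma, at least |F| arcs of B.
  lower-bound : ∀ {SI U} → IsMinFAS I SI → IsFAS A U → size SI + size F ≤ℕ size U
  lower-bound {SI} {U} (_ , least) (_ , acyclic) = begin
    size SI + size F              ≤⟨ +-mono-≤ (least (U ∩A I) U∩I-fas) (hitting (λ i j b → proj₁ (B-arc b)) acyclic) ⟩
    size (U ∩A I) + size (U ∩A B) ≤⟨ size-∩-disjoint U I B (λ i j inner between → proj₂ (B-arc between) (proj₂ (I-arc inner))) ⟩
    size U                        ∎
    where
    open ℕ.≤-Reasoning
    U∩I-fas : IsFAS I (U ∩A I)
    U∩I-fas = (λ i j t → proj₂ (∧⁻ {U i j} t)) ,
              acyclic-⊆ (λ i j t → let (inner , ¬u) = ∖A⁻ {I i j} t in ∖A⁺ (proj₁ (I-arc inner)) (λ u → ¬u (∧⁺ u inner))) acyclic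

  union-minimum : ∀ {SI} → IsMinFAS I SI → IsMinFAS A (SI ∪A F) × size (SI ∪A F) ≡ size SI + size F
  union-minimum {SI} minI =
    (union-fas (proj₁ minI) , λ U fas-U → ≤-trans (size-∪ SI F) (lower-bound minI fas-U)) ,
    ≤-antisym (size-∪ SI F) (lower-bound minI (union-fas (proj₁ minI)))

lemma2 : (n l : ℕ) (A : ArcSet n) (P : IntervalPartition n l) →
         CanBeCertified (backward (arcsB P A)) (arcsB P A) →
         (∀ kI kB → FasIs (arcsI P A) kI → FasIs (arcsB P A) kB → FasIs A (kI + kB)) ×
         Σ (ArcSet n) (λ S → IsMinFAS A S × (backward (arcsB P A) ⊆A S))
lemma2 n l A P certified = additive , SI ∪A F , proj₁ (union-minimum minI) , λ i j f → ∨⁺ʳ f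
  where
  open Decomposition A P certified
  additive : ∀ kI kB → FasIs I kI → FasIs B kB → FasIs A (kI + kB)
  additive _ _ (S , minS , refl) (SB , minB , refl) =
    S ∪A F , proj₁ (union-minimum minS) ,
    trans (proj₂ (union-minimum minS)) (cong (size S +_) (sym (fas-B minB)))
  SI : ArcSet n
  SI = proj₁ (minimum-fas I)
  minI : IsMinFAS I SI
  minI = proj₂ (minimum-fas I)
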